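{- Let $t$ be a $\lambda$-term typable in system $\mathcal{D}$ (i.e. $\Gamma \vdash t : A$ for some context $\Gamma$ and type $A$). Then $t$ is strongly normalizing for the reduction generated by the rules $\beta$, $\delta$, $\gamma$ and $assoc$.
   Context: $\lambda$-terms: $\mathcal{M} ::= x \mid \lambda x.\mathcal{M} \mid (\mathcal{M}\ \mathcal{M})$, up to $\alpha$-conversion, application associating to the left. Rules (applied to any subterm): $\beta$: $(\lambda x.M\ N) \triangleright M[x:=N]$; $\delta$: $(\lambda y.\lambda x.M\ N) \triangleright \lambda x.(\lambda y.M\ N)$ with $x$ not free in $N$; $\gamma$: $(\lambda x.M\ N\ P) \triangleright (\lambda x.(M\ P)\ N)$ with $x$ not free in $P$; $assoc$: $(M\ (\lambda x.N\ P)) \triangleright (\lambda x.(M\ N)\ P)$ with $x$ not free in $M$. System $\mathcal{D}$: types $\mathcal{T} ::= \mathcal{A} \mid \mathcal{T}\to\mathcal{T} \mid \mathcal{T}\wedge\mathcal{T}$ ($\mathcal{A}$ a set of atomic types); typing rules: $\Gamma, x:A \vdash x : A$; from $\Gamma \vdash M : A\to B$ and $\Gamma\vdash N:A$ infer $\Gamma \vdash (M\ N):B$; from $\Gamma, x:A \vdash M:B$ infer $\Gamma\vdash \lambda x.M : A\to B$; from $\Gamma\vdash M:A\wedge B$ infer $\Gamma\vdash M:A$ and $\Gamma\vdash M:B$; from $\Gamma\vdash M:A$ and $\Gamma\vdash M:B$ infer $\Gamma\vdash M:A\wedge B$. -}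

module Defs where

open import Data.Nat using (ℕ; zero; suc)
open import Data.List using (List; []; _∷_)
open import Induction.WellFounded using (Acc)

-- λ-terms up to α-conversion: de Bruijn indices

data Term : Set where
  var : ℕ → Term
  lam : Term → Term
  app : Term → Term → Term

ext : (ℕ → ℕ) → ℕ → ℕ
ext ρ zero    = zero
ext ρ (suc n) = suc (ρ n)

rename : (ℕ → ℕ) → Term → Term
rename ρ (var n)   = var (ρ n)
rename ρ (lam M)   = lam (rename (ext ρ) M)
rename ρ (app M N) = app (rename ρ M) (rename ρ N)

weaken : Term → Term
weaken = rename suc

swap01 : ℕ → ℕ
swap01 zero          = suc zero
swap01 (suc zero)    = zero
swap01 (suc (suc n)) = suc (suc n)

exts : (ℕ → Term) → ℕ → Term
exts σ zero    = var zero
exts σ (suc n) = weaken (σ n)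

subst : (ℕ → Term) → Term → Term
subst σ (var n)   = σ n
subst σ (lam M)   = lam (subst (exts σ) M)
subst σ (app M N) = app (subst σ M) (subst σ N)

sub0 : Term → ℕ → Term
sub0 N zero    = N
sub0 N (suc n) = var n

_[_] : Term → Term → Term
M [ N ] = subst (sub0 N) M

-- One-step reduction: β, δ, γ, assoc, closed under all contexts.
-- The side conditions "x not free in N/P/M" are automatic in de Bruijn
-- notation: the term moved under the binder x is weakened.

infix 4 _⟶_
data _⟶_ : Term → Term → Set where
  β     : ∀ {M N} → app (lam M) N ⟶ M [ N ]
  -- (λy.λx.M N) ▷ λx.(λy.M N)
  δ     : ∀ {M N} →
          app (lam (lam M)) N ⟶ lam (app (lam (rename swap01 M)) (weaken N))
  -- (λx.M N P) ▷ (λx.(M P) N)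
  γ     : ∀ {M N P} →
          app (app (lam M) N) P ⟶ app (lam (app M (weaken P))) N
  -- (M (λx.N P)) ▷ (λx.(M N) P)
  assoc : ∀ {M N P} →
          app M (app (lam N) P) ⟶ app (lam (app (weaken M) N)) P
  ξ-lam  : ∀ {M M'} → M ⟶ M' → lam M ⟶ lam M'
  ξ-appL : ∀ {M M' N} → M ⟶ M' → app M N ⟶ app M' N
  ξ-appR : ∀ {M N N'} → N ⟶ N' → app M N ⟶ app M N'

SN : Term → Set
SN = Acc (λ u t → t ⟶ u)

infixr 7 _⇒_
infixr 8 _∧_
data Type (𝒜 : Set) : Set where
  atom : 𝒜 → Type 𝒜
  _⇒_  : Type 𝒜 → Type 𝒜 → Type 𝒜
  _∧_  : Type 𝒜 → Type 𝒜 → Type 𝒜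

Context : Set → Set
Context 𝒜 = List (Type 𝒜)

infix 4 _∋_⦂_
data _∋_⦂_ {𝒜 : Set} : Context 𝒜 → ℕ → Type 𝒜 → Set where
  here  : ∀ {Γ A} → (A ∷ Γ) ∋ zero ⦂ A
  there : ∀ {Γ A B n} → Γ ∋ n ⦂ A → (B ∷ Γ) ∋ suc n ⦂ A

infix 4 _⊢_⦂_
data _⊢_⦂_ {𝒜 : Set} : Context 𝒜 → Term → Type 𝒜 → Set where
  ax   : ∀ {Γ n A} → Γ ∋ n ⦂ A → Γ ⊢ var n ⦂ A
  →E   : ∀ {Γ M N A B} → Γ ⊢ M ⦂ A ⇒ B → Γ ⊢ N ⦂ A → Γ ⊢ app M N ⦂ B
  →I   : ∀ {Γ M A B} → (A ∷ Γ) ⊢ M ⦂ B → Γ ⊢ lam M ⦂ A ⇒ B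
  ∧E₁  : ∀ {Γ M A B} → Γ ⊢ M ⦂ A ∧ B → Γ ⊢ M ⦂ A
  ∧E₂  : ∀ {Γ M A B} → Γ ⊢ M ⦂ A ∧ B → Γ ⊢ M ⦂ B
  ∧I   : ∀ {Γ M A B} → Γ ⊢ M ⦂ A → Γ ⊢ M ⦂ B → Γ ⊢ M ⦂ A ∧ B

-- Reducibility: types are read as sets of terms, atoms as strongly normalising ones, and every
-- typable term is reducible. Besides the usual closure properties one needs that a redex (λ M) N
-- inside a stack K of applications and abstractions is SN as soon as its contractum and its argument
-- are. The rules δ, γ and assoc move the redex through K instead of contracting it, so "its argument"
-- must be taken as the term it will actually be substituted by, effArg K N; the proof is then a
-- lexicographic induction on effArg K N (under reduction and subterms), on the contractum, and on
-- a size weight of K and M.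

module Submission where

open import Defs
open import Data.Nat using (ℕ; zero; suc; _+_; _<_; s≤s)
open import Data.Nat.Properties using (+-comm; +-monoʳ-<; ≤-reflexive)
open import Data.Nat.Induction using (<-wellFounded)
open import Data.List using (List; []; _∷_; _++_; map)
open import Data.List.Relation.Unary.All as All using (All; []; _∷_)
open import Data.List.Relation.Unary.All.Properties using (++⁻ʳ)
open import Data.List.Relation.Binary.Pointwise as Pointwise using (Pointwise; []; _∷_)
open import Data.Product using (∃-syntax; _,_; _×_; proj₁; proj₂)
open import Data.Sum using (_⊎_; inj₁; inj₂)
open import Function using (_∘_)
open import Induction.WellFounded using (Acc; acc; acc-inverse)
open import Relation.Binary.Construct.Closure.ReflexiveTransitive using (Star; ε; _◅_; _◅◅_; gmap)
open import Relation.Binary.Construct.Closure.Transitive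
  using (TransClosure; _∷_; accessible) renaming ([_] to [_]⁺)
open import Relation.Binary.PropositionalEquality
  using (_≡_; refl; sym; trans; cong; cong₂; _≗_) renaming (subst to transport; subst₂ to transport₂)
open import Relation.Binary.PropositionalEquality.Properties using (module ≡-Reasoning)

infixr 5 _•_
_•_ : Term → (ℕ → Term) → ℕ → Term
(a • σ) zero    = a
(a • σ) (suc n) = σ n

ext-cong : ∀ {ρ ρ'} → ρ ≗ ρ' → ext ρ ≗ ext ρ'
ext-cong h zero    = refl
ext-cong h (suc n) = cong suc (h n)

rename-cong : ∀ {ρ ρ'} → ρ ≗ ρ' → rename ρ ≗ rename ρ'
rename-cong h (var n)   = cong var (h n)
rename-cong h (lam t)   = cong lam (rename-cong (ext-cong h) t)
rename-cong h (app t u) = cong₂ app (rename-cong h t) (rename-cong h u)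

exts-cong : ∀ {σ τ} → σ ≗ τ → exts σ ≗ exts τ
exts-cong h zero    = refl
exts-cong h (suc n) = cong weaken (h n)

subst-cong : ∀ {σ τ} → σ ≗ τ → subst σ ≗ subst τ
subst-cong h (var n)   = h n
subst-cong h (lam t)   = cong lam (subst-cong (exts-cong h) t)
subst-cong h (app t u) = cong₂ app (subst-cong h t) (subst-cong h u)

rename-∘ : ∀ ρ ρ' t → rename ρ (rename ρ' t) ≡ rename (ρ ∘ ρ') t
rename-∘ ρ ρ' (var n)   = refl
rename-∘ ρ ρ' (lam t)   =
  cong lam (trans (rename-∘ (ext ρ) (ext ρ') t) (rename-cong (λ { zero → refl ; (suc n) → refl }) t))
rename-∘ ρ ρ' (app t u) = cong₂ app (rename-∘ ρ ρ' t) (rename-∘ ρ ρ' u)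

subst-rename : ∀ σ ρ t → subst σ (rename ρ t) ≡ subst (σ ∘ ρ) t
subst-rename σ ρ (var n)   = refl
subst-rename σ ρ (lam t)   =
  cong lam (trans (subst-rename (exts σ) (ext ρ) t) (subst-cong (λ { zero → refl ; (suc n) → refl }) t))
subst-rename σ ρ (app t u) = cong₂ app (subst-rename σ ρ t) (subst-rename σ ρ u)

rename-subst : ∀ ρ σ t → rename ρ (subst σ t) ≡ subst (rename ρ ∘ σ) t
rename-subst ρ σ (var n)   = refl
rename-subst ρ σ (lam t)   = cong lam (trans (rename-subst (ext ρ) (exts σ) t) (subst-cong ext-weaken t))
  where
  ext-weaken : rename (ext ρ) ∘ exts σ ≗ exts (rename ρ ∘ σ)
  ext-weaken zero    = refl
  ext-weaken (suc n) = trans (rename-∘ (ext ρ) suc (σ n)) (sym (rename-∘ suc ρ (σ n)))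
rename-subst ρ σ (app t u) = cong₂ app (rename-subst ρ σ t) (rename-subst ρ σ u)

subst-weaken : ∀ σ t → subst (exts σ) (weaken t) ≡ weaken (subst σ t)
subst-weaken σ t = trans (subst-rename (exts σ) suc t) (sym (rename-subst suc σ t))

subst-∘ : ∀ σ τ t → subst τ (subst σ t) ≡ subst (subst τ ∘ σ) t
subst-∘ σ τ (var n)   = refl
subst-∘ σ τ (lam t)   = cong lam (trans (subst-∘ (exts σ) (exts τ) t)
  (subst-cong (λ { zero → refl ; (suc n) → subst-weaken τ (σ n) }) t))
subst-∘ σ τ (app t u) = cong₂ app (subst-∘ σ τ t) (subst-∘ σ τ u)

subst-id : ∀ t → subst var t ≡ t
subst-id (var n)   = refl
subst-id (lam t)   = cong lam (trans (subst-cong (λ { zero → refl ; (suc n) → refl }) t) (subst-id t))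
subst-id (app t u) = cong₂ app (subst-id t) (subst-id u)

rename-as-subst : ∀ ρ t → rename ρ t ≡ subst (var ∘ ρ) t
rename-as-subst ρ t = trans (sym (subst-id (rename ρ t))) (subst-rename var ρ t)

subst-•-weaken : ∀ a σ t → subst (a • σ) (weaken t) ≡ subst σ t
subst-•-weaken a σ t = subst-rename (a • σ) suc t

weaken-[] : ∀ P N → weaken P [ N ] ≡ P
weaken-[] P N = trans (subst-rename (sub0 N) suc P) (subst-id P)

exts-[] : ∀ σ M N → subst (exts σ) M [ N ] ≡ subst (N • σ) M
exts-[] σ M N = trans (subst-∘ (exts σ) (sub0 N) M)
  (subst-cong (λ { zero → refl ; (suc n) → weaken-[] (σ n) N }) M)

subst-[] : ∀ σ M N → subst σ (M [ N ]) ≡ subst (exts σ) M [ subst σ N ]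
subst-[] σ M N = begin
  subst σ (M [ N ])                 ≡⟨ subst-∘ (sub0 N) σ M ⟩
  subst (subst σ ∘ sub0 N) M        ≡⟨ subst-cong (λ { zero → refl ; (suc n) → refl }) M ⟩
  subst (subst σ N • σ) M           ≡⟨ exts-[] σ M (subst σ N) ⟨
  subst (exts σ) M [ subst σ N ]    ∎
  where open ≡-Reasoning

swap01-[weaken] : ∀ M N → rename swap01 M [ weaken N ] ≡ subst (exts (sub0 N)) M
swap01-[weaken] M N = trans (subst-rename (sub0 (weaken N)) swap01 M)
  (subst-cong (λ { zero → refl ; (suc zero) → refl ; (suc (suc n)) → refl }) M)

swap01-exts² : ∀ σ M → rename swap01 (subst (exts (exts σ)) M) ≡ subst (exts (exts σ)) (rename swap01 M)
swap01-exts² σ M = trans (rename-subst swap01 (exts (exts σ)) M)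
  (trans (subst-cong swap-ext² M) (sym (subst-rename (exts (exts σ)) swap01 M)))
  where
  swap-ext² : rename swap01 ∘ exts (exts σ) ≗ exts (exts σ) ∘ swap01
  swap-ext² zero          = refl
  swap-ext² (suc zero)    = refl
  swap-ext² (suc (suc n)) = trans (rename-∘ swap01 suc (weaken (σ n)))
    (trans (rename-∘ (swap01 ∘ suc) suc (σ n)) (sym (rename-∘ suc suc (σ n))))

ext-suc-exts-[] : ∀ M N → subst (exts (sub0 N)) (rename (ext suc) M) ≡ M
ext-suc-exts-[] M N = trans (subst-rename (exts (sub0 N)) (ext suc) M)
  (trans (subst-cong (λ { zero → refl ; (suc n) → refl }) M) (subst-id M))

⟶-subst : ∀ σ {t u} → t ⟶ u → subst σ t ⟶ subst σ u
⟶-subst σ (β {M} {N}) = transport (subst σ (app (lam M) N) ⟶_) (sym (subst-[] σ M N)) β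
⟶-subst σ (δ {M} {N}) = transport (subst σ (app (lam (lam M)) N) ⟶_)
  (cong₂ (λ a b → lam (app (lam a) b)) (swap01-exts² σ M) (sym (subst-weaken σ N))) δ
⟶-subst σ (γ {M} {N} {P}) = transport (subst σ (app (app (lam M) N) P) ⟶_)
  (cong (λ b → app (lam (app (subst (exts σ) M) b)) (subst σ N)) (sym (subst-weaken σ P))) γ
⟶-subst σ (assoc {M} {N} {P}) = transport (subst σ (app M (app (lam N) P)) ⟶_)
  (cong (λ b → app (lam (app b (subst (exts σ) N))) (subst σ P)) (sym (subst-weaken σ M))) assoc
⟶-subst σ (ξ-lam s)  = ξ-lam (⟶-subst (exts σ) s)
⟶-subst σ (ξ-appL s) = ξ-appL (⟶-subst σ s)
⟶-subst σ (ξ-appR s) = ξ-appR (⟶-subst σ s)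

⟶-rename : ∀ ρ {t u} → t ⟶ u → rename ρ t ⟶ rename ρ u
⟶-rename ρ {t} {u} s = transport₂ _⟶_ (sym (rename-as-subst ρ t)) (sym (rename-as-subst ρ u))
  (⟶-subst (var ∘ ρ) s)

infix 4 _⟶*_
_⟶*_ : Term → Term → Set
_⟶*_ = Star _⟶_

subst-⟶* : ∀ {σ τ} → (∀ n → σ n ⟶* τ n) → ∀ t → subst σ t ⟶* subst τ t
subst-⟶* h (var n)   = h n
subst-⟶* h (lam t)   =
  gmap lam ξ-lam (subst-⟶* (λ { zero → ε ; (suc n) → gmap weaken (⟶-rename suc) (h n) }) t)
subst-⟶* {σ} {τ} h (app t u) =
  gmap (λ z → app z (subst σ u)) ξ-appL (subst-⟶* h t) ◅◅ gmap (app (subst τ t)) ξ-appR (subst-⟶* h u)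

SN-⟶ : ∀ {t u} → SN t → t ⟶ u → SN u
SN-⟶ a s = acc-inverse a s

SN-⟶* : ∀ {t u} → SN t → t ⟶* u → SN u
SN-⟶* a ε       = a
SN-⟶* a (s ◅ p) = SN-⟶* (SN-⟶ a s) p

SN-app-fun : ∀ {t u} → SN (app t u) → SN t
SN-app-fun (acc rs) = acc (λ s → SN-app-fun (rs (ξ-appL s)))

SN-app-arg : ∀ {t u} → SN (app t u) → SN u
SN-app-arg (acc rs) = acc (λ s → SN-app-arg (rs (ξ-appR s)))

infix 4 _⊲_ _⊴_ _≺_ _≺⁺_
data _⊲_ : Term → Term → Set where
  ⊲-lam  : ∀ {t}   → t ⊲ lam t
  ⊲-appL : ∀ {t u} → t ⊲ app t u
  ⊲-appR : ∀ {t u} → u ⊲ app t u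

_⊴_ : Term → Term → Set
_⊴_ = Star _⊲_

_≺_ : Term → Term → Set
u ≺ t = (t ⟶ u) ⊎ (u ⊲ t)

_≺⁺_ : Term → Term → Set
_≺⁺_ = TransClosure _≺_

⊲-⟶ : ∀ {u t u'} → u ⊲ t → u ⟶ u' → ∃[ t' ] (t ⟶ t' × u' ⊲ t')
⊲-⟶ ⊲-lam  s = _ , ξ-lam s  , ⊲-lam
⊲-⟶ ⊲-appL s = _ , ξ-appL s , ⊲-appL
⊲-⟶ ⊲-appR s = _ , ξ-appR s , ⊲-appR

⊴-⟶ : ∀ {u t u'} → u ⊴ t → u ⟶ u' → ∃[ t' ] (t ⟶ t' × u' ⊴ t')
⊴-⟶ ε       s = _ , s , ε
⊴-⟶ (p ◅ q) s with ⊲-⟶ p s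
... | v' , s' , p' with ⊴-⟶ q s'
...   | t' , s'' , q' = t' , s'' , p' ◅ q'

-- Generalised to subterms so that ⊲-steps recurse structurally on the subterm.
SN⇒acc-≺-⊴ : ∀ {t} → SN t → ∀ u → u ⊴ t → Acc _≺_ u
SN⇒acc-≺-⊴ a u p = acc (below a u p)
  where
  below : ∀ {t} → SN t → ∀ u → u ⊴ t → ∀ {y} → y ≺ u → Acc _≺_ y
  below (acc rs) u p (inj₁ s) with ⊴-⟶ p s
  ... | t' , s' , p' = SN⇒acc-≺-⊴ (rs s') _ p'
  below a (lam y)   p (inj₂ ⊲-lam)  = SN⇒acc-≺-⊴ a y (⊲-lam ◅ p)
  below a (app y _) p (inj₂ ⊲-appL) = SN⇒acc-≺-⊴ a y (⊲-appL ◅ p)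
  below a (app _ y) p (inj₂ ⊲-appR) = SN⇒acc-≺-⊴ a y (⊲-appR ◅ p)

SN⇒acc-≺⁺ : ∀ {t} → SN t → Acc _≺⁺_ t
SN⇒acc-≺⁺ a = accessible _≺_ (SN⇒acc-≺-⊴ a _ ε)

⟶*⇒≺⁺ : ∀ {t u v} → t ⟶ u → u ⟶* v → v ≺⁺ t
⟶*⇒≺⁺ s p = extend [ inj₁ s ]⁺ p
  where
  extend : ∀ {t u v} → u ≺⁺ t → u ⟶* v → v ≺⁺ t
  extend q ε       = q
  extend q (s ◅ p) = extend (inj₁ s ∷ q) p

⟶*⇒≡⊎≺⁺ : ∀ {t u} → t ⟶* u → u ≡ t ⊎ u ≺⁺ t
⟶*⇒≡⊎≺⁺ ε       = inj₁ refl
⟶*⇒≡⊎≺⁺ (s ◅ p) = inj₂ (⟶*⇒≺⁺ s p)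

data Frame : Set where
  farg : Term → Frame
  flam : Frame

Frames : Set
Frames = List Frame

plug : Frames → Term → Term
plug []           t = t
plug (farg P ∷ K) t = app (plug K t) P
plug (flam ∷ K)   t = lam (plug K t)

plug-⟶ : ∀ K {t u} → t ⟶ u → plug K t ⟶ plug K u
plug-⟶ []           s = s
plug-⟶ (farg P ∷ K) s = ξ-appL (plug-⟶ K s)
plug-⟶ (flam ∷ K)   s = ξ-lam (plug-⟶ K s)

substF : (ℕ → Term) → Frames → Frames
substF σ []           = []
substF σ (farg P ∷ K) = farg (subst σ P) ∷ substF σ K
substF σ (flam ∷ K)   = flam ∷ substF (exts σ) K

underF : (ℕ → Term) → Frames → ℕ → Term
underF σ []           = σ
underF σ (farg P ∷ K) = underF σ K
underF σ (flam ∷ K)   = underF (exts σ) K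

subst-plug : ∀ σ K t → subst σ (plug K t) ≡ plug (substF σ K) (subst (underF σ K) t)
subst-plug σ []           t = refl
subst-plug σ (farg P ∷ K) t = cong (λ z → app z (subst σ P)) (subst-plug σ K t)
subst-plug σ (flam ∷ K)   t = cong lam (subst-plug (exts σ) K t)

-- Junk value: an abstraction of the spine without a matching argument receives var 0.
hd : List Term → Term
hd []      = var zero
hd (a ∷ S) = a

tl : List Term → List Term
tl []      = []
tl (a ∷ S) = S

-- Reading K from the outside in, arguments are pushed on the stack S and each abstraction pops the
-- argument it would receive if the spine were head-reduced.
spineEnv : (ℕ → Term) → List Term → Frames → ℕ → Term
spineEnv σ S []           = σ
spineEnv σ S (farg P ∷ K) = spineEnv σ (subst σ P ∷ S) K
spineEnv σ S (flam ∷ K)   = spineEnv (hd S • σ) (tl S) K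

effArgIn : (ℕ → Term) → List Term → Frames → Term → Term
effArgIn σ S K N = subst (spineEnv σ S K) N

effArg : Frames → Term → Term
effArg = effArgIn var []

spineEnv-substF : ∀ θ σ σ' S K → subst σ ∘ θ ≗ σ' →
                  subst (spineEnv σ S (substF θ K)) ∘ underF θ K ≗ spineEnv σ' S K
spineEnv-substF θ σ σ' S []           h = h
spineEnv-substF θ σ σ' S (farg P ∷ K) h n
  rewrite trans (subst-∘ θ σ P) (subst-cong h P) = spineEnv-substF θ σ σ' (subst σ' P ∷ S) K h n
spineEnv-substF θ σ σ' S (flam ∷ K)   h =
  spineEnv-substF (exts θ) (hd S • σ) (hd S • σ') (tl S) K λ
    { zero → refl ; (suc n) → trans (subst-•-weaken (hd S) σ (θ n)) (h n) }

effArgIn-substF : ∀ θ σ σ' S K N → subst σ ∘ θ ≗ σ' →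
                  effArgIn σ S (substF θ K) (subst (underF θ K) N) ≡ effArgIn σ' S K N
effArgIn-substF θ σ σ' S K N h =
  trans (subst-∘ (underF θ K) (spineEnv σ S (substF θ K)) N) (subst-cong (spineEnv-substF θ σ σ' S K h) N)

spineEnv-⟶* : ∀ {σ σ' S S'} K → (∀ n → σ n ⟶* σ' n) → Pointwise _⟶*_ S S' →
              ∀ n → spineEnv σ S K n ⟶* spineEnv σ' S' K n
spineEnv-⟶* []           h p = h
spineEnv-⟶* (farg P ∷ K) h p = spineEnv-⟶* K h (subst-⟶* h P ∷ p)
spineEnv-⟶* (flam ∷ K)   h []      = spineEnv-⟶* K (λ { zero → ε ; (suc n) → h n }) []
spineEnv-⟶* (flam ∷ K)   h (q ∷ p) = spineEnv-⟶* K (λ { zero → q ; (suc n) → h n }) p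

effArgIn-stack-⟶ : ∀ σ S K {a a'} → a ⟶ a' →
                   ∀ N → effArgIn σ (a ∷ S) K N ⟶* effArgIn σ (a' ∷ S) K N
effArgIn-stack-⟶ σ S K s = subst-⟶* (spineEnv-⟶* K (λ _ → ε) ((s ◅ ε) ∷ Pointwise.refl ε))

size : Term → ℕ
size (var n)   = 1
size (lam t)   = suc (size t)
size (app t u) = suc (size t + size u)

size-rename : ∀ ρ t → size (rename ρ t) ≡ size t
size-rename ρ (var n)   = refl
size-rename ρ (lam t)   = cong suc (size-rename (ext ρ) t)
size-rename ρ (app t u) = cong₂ (λ a b → suc (a + b)) (size-rename ρ t) (size-rename ρ u)

weight : Frames → Term → ℕ
weight []           M = size M
weight (farg P ∷ K) M = suc (suc (size P + weight K M))
weight (flam ∷ K)   M = weight K M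

contractum : Frames → Term → Term → Term
contractum K M N = plug K (M [ N ])

-- One step from the redex plug K (app (lam M) N) to the redex plug K' (app (lam M') N'),
-- decreasing the triple (effArg, contractum, weight) lexicographically.
data Descent (K : Frames) (M N : Term) (K' : Frames) (M' N' : Term) : Set where
  contractum-⟶ : (∀ σ S → effArgIn σ S K' N' ≡ effArgIn σ S K N) →
                 contractum K M N ⟶ contractum K' M' N' → Descent K M N K' M' N'
  effArg-⟶     : (∀ σ S → effArgIn σ S K N ⟶ effArgIn σ S K' N') →
                 contractum K M N ⟶* contractum K' M' N' → Descent K M N K' M' N'
  effArg-⟶*    : (∀ σ S → effArgIn σ S K N ⟶* effArgIn σ S K' N') →
                 contractum K M N ⟶ contractum K' M' N' → Descent K M N K' M' N'
  weight-<     : (∀ σ S → effArgIn σ S K' N' ≡ effArgIn σ S K N) →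
                 contractum K' M' N' ≡ contractum K M N → weight K' M' < weight K M →
                 Descent K M N K' M' N'

data RedexStep (K : Frames) (M N : Term) : Term → Set where
  contract  : RedexStep K M N (contractum K M N)
  assoc-arg : ∀ A B → N ≡ app (lam A) B →
              RedexStep K M N (plug K (app (lam (app (lam (rename (ext suc) M)) A)) B))
  descend   : ∀ K' M' N' → Descent K M N K' M' N' → RedexStep K M N (plug K' (app (lam M') N'))

Descent-farg : ∀ {K M N K' M' N'} P → Descent K M N K' M' N' → Descent (farg P ∷ K) M N (farg P ∷ K') M' N'
Descent-farg P (contractum-⟶ e s) = contractum-⟶ (λ σ S → e σ (subst σ P ∷ S)) (ξ-appL s)
Descent-farg P (effArg-⟶ e p)     = effArg-⟶ (λ σ S → e σ (subst σ P ∷ S)) (gmap (λ z → app z P) ξ-appL p)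
Descent-farg P (effArg-⟶* e s)    = effArg-⟶* (λ σ S → e σ (subst σ P ∷ S)) (ξ-appL s)
Descent-farg P (weight-< e h l)   =
  weight-< (λ σ S → e σ (subst σ P ∷ S)) (cong (λ z → app z P) h) (s≤s (s≤s (+-monoʳ-< (size P) l)))

Descent-flam : ∀ {K M N K' M' N'} → Descent K M N K' M' N' → Descent (flam ∷ K) M N (flam ∷ K') M' N'
Descent-flam (contractum-⟶ e s) = contractum-⟶ (λ σ S → e (hd S • σ) (tl S)) (ξ-lam s)
Descent-flam (effArg-⟶ e p)     = effArg-⟶ (λ σ S → e (hd S • σ) (tl S)) (gmap lam ξ-lam p)
Descent-flam (effArg-⟶* e s)    = effArg-⟶* (λ σ S → e (hd S • σ) (tl S)) (ξ-lam s)
Descent-flam (weight-< e h l)   = weight-< (λ σ S → e (hd S • σ) (tl S)) (cong lam h) l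

RedexStep-farg : ∀ {K M N T} P → RedexStep K M N T → RedexStep (farg P ∷ K) M N (app T P)
RedexStep-farg P contract              = contract
RedexStep-farg P (assoc-arg A B e)     = assoc-arg A B e
RedexStep-farg P (descend K' M' N' d)  = descend (farg P ∷ K') M' N' (Descent-farg P d)

RedexStep-flam : ∀ {K M N T} → RedexStep K M N T → RedexStep (flam ∷ K) M N (lam T)
RedexStep-flam contract             = contract
RedexStep-flam (assoc-arg A B e)    = assoc-arg A B e
RedexStep-flam (descend K' M' N' d) = descend (flam ∷ K') M' N' (Descent-flam d)

step-in-arg : ∀ K M N {P P'} → P ⟶ P' → RedexStep (farg P ∷ K) M N (app (plug K (app (lam M) N)) P')
step-in-arg K M N s = descend (farg _ ∷ K) M N
  (effArg-⟶* (λ σ S → effArgIn-stack-⟶ σ S K (⟶-subst σ s) N) (ξ-appR s))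

weaken-plug : ∀ K t → weaken (plug K t) ≡ plug (substF (var ∘ suc) K) (subst (underF (var ∘ suc) K) t)
weaken-plug K t = trans (rename-as-subst suc (plug K t)) (subst-plug (var ∘ suc) K t)

-- The redex moves under the binder of (λ A) B, so its effective argument changes only by the
-- contraction of that outer redex.
step-assoc : ∀ K M N A B →
  RedexStep (farg (app (lam A) B) ∷ K) M N (app (lam (app (weaken (plug K (app (lam M) N))) A)) B)
step-assoc K M N A B = transport (RedexStep (farg (app (lam A) B) ∷ K) M N) (sym shape)
  (descend K' (subst (exts θ) M) (subst θ N) (effArg-⟶* effArg-reduces contractum-step))
  where
  θ  = underF (var ∘ suc) K
  K' = farg B ∷ flam ∷ farg A ∷ substF (var ∘ suc) K
  shape : app (lam (app (weaken (plug K (app (lam M) N))) A)) B ≡ plug K' (app (lam (subst (exts θ) M)) (subst θ N))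
  shape = cong (λ z → app (lam (app z A)) B) (weaken-plug K (app (lam M) N))
  effArg-reduces : ∀ σ S → effArgIn σ S (farg (app (lam A) B) ∷ K) N ⟶* effArgIn σ S K' (subst θ N)
  effArg-reduces σ S = transport (effArgIn σ S (farg (app (lam A) B) ∷ K) N ⟶*_)
    (sym (effArgIn-substF (var ∘ suc) (subst σ B • σ) σ (subst (subst σ B • σ) A ∷ S) K N (λ _ → refl)))
    (effArgIn-stack-⟶ σ S K
      (transport (app (lam (subst (exts σ) A)) (subst σ B) ⟶_) (exts-[] σ A (subst σ B)) β) N)
  contractum-step : contractum (farg (app (lam A) B) ∷ K) M N ⟶ contractum K' (subst (exts θ) M) (subst θ N)
  contractum-step = transport (λ z → contractum (farg (app (lam A) B) ∷ K) M N ⟶ app (lam (app z A)) B)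
    (trans (weaken-plug K (M [ N ])) (cong (plug (substF (var ∘ suc) K)) (subst-[] θ M N))) assoc

step-β : ∀ K M N P → RedexStep (farg P ∷ flam ∷ K) M N (plug K (app (lam M) N) [ P ])
step-β K M N P = transport (RedexStep (farg P ∷ flam ∷ K) M N) (sym (subst-plug (sub0 P) K (app (lam M) N)))
  (descend (substF (sub0 P) K) (subst (exts θ) M) (subst θ N) (contractum-⟶ same-effArg contractum-step))
  where
  θ = underF (sub0 P) K
  same-effArg : ∀ σ S → effArgIn σ S (substF (sub0 P) K) (subst θ N) ≡ effArgIn σ S (farg P ∷ flam ∷ K) N
  same-effArg σ S = effArgIn-substF (sub0 P) σ (subst σ P • σ) S K N λ { zero → refl ; (suc n) → refl }
  contractum-step : contractum (farg P ∷ flam ∷ K) M N ⟶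
                    contractum (substF (sub0 P) K) (subst (exts θ) M) (subst θ N)
  contractum-step = transport (contractum (farg P ∷ flam ∷ K) M N ⟶_)
    (trans (subst-plug (sub0 P) K (M [ N ])) (cong (plug (substF (sub0 P) K)) (subst-[] θ M N))) β

step-δ : ∀ K M N P → RedexStep (farg P ∷ flam ∷ flam ∷ K) M N
                                (lam (app (lam (rename swap01 (plug K (app (lam M) N)))) (weaken P)))
step-δ K M N P = transport (RedexStep (farg P ∷ flam ∷ flam ∷ K) M N) (sym shape)
  (descend K' (subst (exts θ) M) (subst θ N) (contractum-⟶ same-effArg contractum-step))
  where
  θ  = underF (var ∘ swap01) K
  K' = flam ∷ farg (weaken P) ∷ flam ∷ substF (var ∘ swap01) K
  swap-plug : ∀ t → rename swap01 (plug K t) ≡ plug (substF (var ∘ swap01) K) (subst θ t)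
  swap-plug t = trans (rename-as-subst swap01 (plug K t)) (subst-plug (var ∘ swap01) K t)
  shape : lam (app (lam (rename swap01 (plug K (app (lam M) N)))) (weaken P))
          ≡ plug K' (app (lam (subst (exts θ) M)) (subst θ N))
  shape = cong (λ z → lam (app (lam z) (weaken P))) (swap-plug (app (lam M) N))
  same-effArg : ∀ σ S → effArgIn σ S K' (subst θ N) ≡ effArgIn σ S (farg P ∷ flam ∷ flam ∷ K) N
  same-effArg σ S = effArgIn-substF (var ∘ swap01) (subst (hd S • σ) (weaken P) • hd S • σ)
    (hd S • subst σ P • σ) (tl S) K N
    λ { zero → refl ; (suc zero) → subst-•-weaken (hd S) σ P ; (suc (suc n)) → refl }
  contractum-step : contractum (farg P ∷ flam ∷ flam ∷ K) M N ⟶ contractum K' (subst (exts θ) M) (subst θ N)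
  contractum-step = transport (λ z → contractum (farg P ∷ flam ∷ flam ∷ K) M N ⟶ lam (app (lam z) (weaken P)))
    (trans (swap-plug (M [ N ])) (cong (plug (substF (var ∘ swap01) K)) (subst-[] θ M N))) δ

step-γ : ∀ K M N P Q → RedexStep (farg P ∷ farg Q ∷ flam ∷ K) M N
                                  (app (lam (app (plug K (app (lam M) N)) (weaken P))) Q)
step-γ K M N P Q = descend (farg Q ∷ flam ∷ farg (weaken P) ∷ K) M N (contractum-⟶ same-effArg γ)
  where
  same-effArg : ∀ σ S → effArgIn σ S (farg Q ∷ flam ∷ farg (weaken P) ∷ K) N
                      ≡ effArgIn σ S (farg P ∷ farg Q ∷ flam ∷ K) N
  same-effArg σ S = cong (λ z → effArgIn (subst σ Q • σ) (z ∷ S) K N) (subst-•-weaken (subst σ Q) σ P)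

view-step : ∀ K M N {T} → plug K (app (lam M) N) ⟶ T → RedexStep K M N T
view-step [] M N β = contract
view-step [] (lam M) N δ = descend (flam ∷ []) (rename swap01 M) (weaken N)
  (weight-< (λ σ S → subst-•-weaken (hd S) σ N) (cong lam (swap01-[weaken] M N))
            (s≤s (≤-reflexive (size-rename swap01 M))))
view-step [] M _ (assoc {N = A} {P = B}) = assoc-arg A B refl
view-step [] M N (ξ-appL (ξ-lam {M' = M'} s)) =
  descend [] M' N (contractum-⟶ (λ _ _ → refl) (⟶-subst (sub0 N) s))
view-step [] M N (ξ-appR {N' = N'} s) =
  descend [] M N' (effArg-⟶ (λ σ S → ⟶-subst σ s) (subst-⟶* arg-⟶* M))
  where
  arg-⟶* : ∀ n → sub0 N n ⟶* sub0 N' n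
  arg-⟶* zero    = s ◅ ε
  arg-⟶* (suc n) = ε
view-step (flam ∷ K) M N (ξ-lam s) = RedexStep-flam (view-step K M N s)
view-step (farg P ∷ []) M N (ξ-appL s) = RedexStep-farg P (view-step [] M N s)
view-step (farg P ∷ []) M N (ξ-appR s) = step-in-arg [] M N s
view-step (farg P ∷ []) M N (assoc {N = A} {P = B}) = step-assoc [] M N A B
view-step (farg P ∷ []) M N γ = descend [] (app M (weaken P)) N
  (weight-< (λ _ _ → refl) (cong (app (M [ N ])) (weaken-[] P N))
            (s≤s (s≤s (≤-reflexive (trans (cong (size M +_) (size-rename suc P)) (+-comm (size M) (size P)))))))
view-step (farg P ∷ flam ∷ []) M N (ξ-appL s) = RedexStep-farg P (view-step (flam ∷ []) M N s)
view-step (farg P ∷ flam ∷ []) M N (ξ-appR s) = step-in-arg (flam ∷ []) M N s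
view-step (farg P ∷ flam ∷ []) M N (assoc {N = A} {P = B}) = step-assoc (flam ∷ []) M N A B
view-step (farg P ∷ flam ∷ []) M N β = step-β [] M N P
view-step (farg P ∷ flam ∷ flam ∷ K) M N (ξ-appL s) = RedexStep-farg P (view-step (flam ∷ flam ∷ K) M N s)
view-step (farg P ∷ flam ∷ flam ∷ K) M N (ξ-appR s) = step-in-arg (flam ∷ flam ∷ K) M N s
view-step (farg P ∷ flam ∷ flam ∷ K) M N (assoc {N = A} {P = B}) = step-assoc (flam ∷ flam ∷ K) M N A B
view-step (farg P ∷ flam ∷ flam ∷ K) M N β = step-β (flam ∷ K) M N P
view-step (farg P ∷ flam ∷ flam ∷ K) M N δ = step-δ K M N P
view-step (farg P ∷ flam ∷ farg Q ∷ K) M N (ξ-appL s) = RedexStep-farg P (view-step (flam ∷ farg Q ∷ K) M N s)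
view-step (farg P ∷ flam ∷ farg Q ∷ K) M N (ξ-appR s) = step-in-arg (flam ∷ farg Q ∷ K) M N s
view-step (farg P ∷ flam ∷ farg Q ∷ K) M N (assoc {N = A} {P = B}) = step-assoc (flam ∷ farg Q ∷ K) M N A B
view-step (farg P ∷ flam ∷ farg Q ∷ K) M N β = step-β (farg Q ∷ K) M N P
view-step (farg P ∷ farg Q ∷ []) M N (ξ-appL s) = RedexStep-farg P (view-step (farg Q ∷ []) M N s)
view-step (farg P ∷ farg Q ∷ []) M N (ξ-appR s) = step-in-arg (farg Q ∷ []) M N s
view-step (farg P ∷ farg Q ∷ []) M N (assoc {N = A} {P = B}) = step-assoc (farg Q ∷ []) M N A B
view-step (farg P ∷ farg Q ∷ flam ∷ K) M N (ξ-appL s) = RedexStep-farg P (view-step (farg Q ∷ flam ∷ K) M N s)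
view-step (farg P ∷ farg Q ∷ flam ∷ K) M N (ξ-appR s) = step-in-arg (farg Q ∷ flam ∷ K) M N s
view-step (farg P ∷ farg Q ∷ flam ∷ K) M N (assoc {N = A} {P = B}) = step-assoc (farg Q ∷ flam ∷ K) M N A B
view-step (farg P ∷ farg Q ∷ flam ∷ K) M N γ = step-γ K M N P Q
view-step (farg P ∷ farg Q ∷ farg R ∷ K) M N (ξ-appL s) = RedexStep-farg P (view-step (farg Q ∷ farg R ∷ K) M N s)
view-step (farg P ∷ farg Q ∷ farg R ∷ K) M N (ξ-appR s) = step-in-arg (farg Q ∷ farg R ∷ K) M N s
view-step (farg P ∷ farg Q ∷ farg R ∷ K) M N (assoc {N = A} {P = B}) = step-assoc (farg Q ∷ farg R ∷ K) M N A B

plug-⟶* : ∀ K {t u} → t ⟶* u → plug K t ⟶* plug K u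
plug-⟶* K = gmap (plug K) (plug-⟶ K)

mutual
  SN-redex : ∀ {X H m} → Acc _≺⁺_ X → SN H → Acc _<_ m → ∀ K M N →
             effArg K N ≡ X → contractum K M N ≡ H → weight K M ≡ m → SN (plug K (app (lam M) N))
  SN-redex aX aH am K M N eX eH em = acc λ s → SN-redexStep aX aH am K M N eX eH em (view-step K M N s)

  SN-redexStep : ∀ {X H m} → Acc _≺⁺_ X → SN H → Acc _<_ m → ∀ K M N →
                 effArg K N ≡ X → contractum K M N ≡ H → weight K M ≡ m →
                 ∀ {T} → RedexStep K M N T → SN T
  SN-redexStep aX aH am K M N eX eH em contract = transport SN (sym eH) aH
  SN-redexStep aX (acc rsH) am K M N eX eH em (descend K' M' N' (contractum-⟶ e s)) =
    SN-redex aX (rsH (transport (_⟶ _) eH s)) (<-wellFounded _) K' M' N' (trans (e var []) eX) refl refl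
  SN-redexStep (acc rsX) aH am K M N eX eH em (descend K' M' N' (effArg-⟶ e p)) =
    SN-redex (rsX [ inj₁ (transport (_⟶ _) eX (e var [])) ]⁺) (SN-⟶* aH (transport (_⟶* _) eH p))
      (<-wellFounded _) K' M' N' refl refl refl
  SN-redexStep aX aH am K M N eX eH em (descend K' M' N' (effArg-⟶* e s)) =
    SN-redex-after aX aH K' M' N' (transport (_⟶ _) eH s) (⟶*⇒≡⊎≺⁺ (transport (_⟶* _) eX (e var [])))
  SN-redexStep aX aH (acc rsm) K M N eX eH em (descend K' M' N' (weight-< e h l)) =
    SN-redex aX aH (rsm (transport (weight K' M' <_) em l)) K' M' N' (trans (e var []) eX) (trans h eH) refl
  SN-redexStep (acc rsX) aH am K M _ eX eH em (assoc-arg A B refl) =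
    SN-redex (rsX [ inj₂ (transport (effArg K B ⊲_) eX ⊲-appR) ]⁺) SN-contractum
      (<-wellFounded _) K (app (lam (rename (ext suc) M)) A) B refl refl refl
    where
    env = spineEnv var [] K
    effArg-β : effArg K (app (lam A) B) ⟶ effArg K (A [ B ])
    effArg-β = transport (app (lam (subst (exts env) A)) (subst env B) ⟶_) (sym (subst-[] env A B)) β
    contractum-β : contractum K M (app (lam A) B) ⟶* contractum K M (A [ B ])
    contractum-β = plug-⟶* K (subst-⟶* (λ { zero → β ◅ ε ; (suc n) → ε }) M)
    SN-contractum : SN (contractum K (app (lam (rename (ext suc) M)) A) B)
    SN-contractum = transport SN (cong (λ z → plug K (app (lam z) (A [ B ]))) (sym (ext-suc-exts-[] M B)))
      (SN-redex (rsX [ inj₁ (transport (_⟶ _) eX effArg-β) ]⁺) (SN-⟶* aH (transport (_⟶* _) eH contractum-β))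
        (<-wellFounded _) K M (A [ B ]) refl refl refl)

  SN-redex-after : ∀ {X H} → Acc _≺⁺_ X → SN H → ∀ K M N → H ⟶ contractum K M N →
                   effArg K N ≡ X ⊎ effArg K N ≺⁺ X → SN (plug K (app (lam M) N))
  SN-redex-after aX        (acc rsH) K M N s (inj₁ eq) = SN-redex aX (rsH s) (<-wellFounded _) K M N eq refl refl
  SN-redex-after (acc rsX) (acc rsH) K M N s (inj₂ lt) = SN-redex (rsX lt) (rsH s) (<-wellFounded _) K M N refl refl refl

SN-β-expansion : ∀ K M N → SN (effArg K N) → SN (contractum K M N) → SN (plug K (app (lam M) N))
SN-β-expansion K M N sN sH = SN-redex (SN⇒acc-≺⁺ sN) sH (<-wellFounded _) K M N refl refl refl

spineEnv-args : ∀ σ S ps → spineEnv σ S (map farg ps) ≡ σ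
spineEnv-args σ S []       = refl
spineEnv-args σ S (p ∷ ps) = spineEnv-args σ (subst σ p ∷ S) ps

effArg-args : ∀ ps N → effArg (map farg ps) N ≡ N
effArg-args ps N = trans (cong (λ σ → subst σ N) (spineEnv-args var [] ps)) (subst-id N)

plug-args-++ : ∀ po q pi t →
               plug (map farg (po ++ q ∷ pi)) t ≡ plug (map farg po) (app (plug (map farg pi) t) q)
plug-args-++ []       q pi t = refl
plug-args-++ (p ∷ po) q pi t = cong (λ z → app z p) (plug-args-++ po q pi t)

infix 4 _⟶ˢ_
data _⟶ˢ_ : List Term → List Term → Set where
  here  : ∀ {p p' ps} → p ⟶ p' → (p ∷ ps) ⟶ˢ (p' ∷ ps)
  there : ∀ {p ps ps'} → ps ⟶ˢ ps' → (p ∷ ps) ⟶ˢ (p ∷ ps')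

SNˢ : List Term → Set
SNˢ = Acc (λ qs ps → ps ⟶ˢ qs)

⟶ˢ-++ : ∀ po {q q'} pi → q ⟶ q' → (po ++ q ∷ pi) ⟶ˢ (po ++ q' ∷ pi)
⟶ˢ-++ []       pi s = here s
⟶ˢ-++ (p ∷ po) pi s = there (⟶ˢ-++ po pi s)

All-SN-⟶ˢ : ∀ {ps ps'} → ps ⟶ˢ ps' → All SN ps → All SN ps'
All-SN-⟶ˢ (here s)  (a ∷ as) = SN-⟶ a s ∷ as
All-SN-⟶ˢ (there q) (a ∷ as) = a ∷ All-SN-⟶ˢ q as

SNˢ-∷ : ∀ {p ps} → SN p → SNˢ ps → SNˢ (p ∷ ps)
SNˢ-∷ (acc rp) (acc rps) = acc λ
  { (here s)  → SNˢ-∷ (rp s) (acc rps)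
  ; (there q) → SNˢ-∷ (acc rp) (rps q)
  }

All-SN⇒SNˢ : ∀ {ps} → All SN ps → SNˢ ps
All-SN⇒SNˢ []       = acc λ ()
All-SN⇒SNˢ (a ∷ as) = SNˢ-∷ a (All-SN⇒SNˢ as)

data NeutralStep (x : ℕ) (ps : List Term) : Term → Set where
  args-⟶   : ∀ {ps'} → ps ⟶ˢ ps' → NeutralStep x ps (plug (map farg ps') (var x))
  assoc-at : ∀ po A B pi → ps ≡ po ++ app (lam A) B ∷ pi →
             NeutralStep x ps (plug (map farg po) (app (lam (app (weaken (plug (map farg pi) (var x))) A)) B))

NeutralStep-∷ : ∀ {x ps T} p → NeutralStep x ps T → NeutralStep x (p ∷ ps) (app T p)
NeutralStep-∷ p (args-⟶ q)             = args-⟶ (there q)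
NeutralStep-∷ p (assoc-at po A B pi e) = assoc-at (p ∷ po) A B pi (cong (p ∷_) e)

view-neutral : ∀ x ps {T} → plug (map farg ps) (var x) ⟶ T → NeutralStep x ps T
view-neutral x (p ∷ []) (ξ-appL ())
view-neutral x (p ∷ []) (ξ-appR s) = args-⟶ (here s)
view-neutral x (p ∷ []) assoc = assoc-at [] _ _ [] refl
view-neutral x (p ∷ q ∷ []) (ξ-appL s) = NeutralStep-∷ p (view-neutral x (q ∷ []) s)
view-neutral x (p ∷ q ∷ []) (ξ-appR s) = args-⟶ (here s)
view-neutral x (p ∷ q ∷ []) assoc = assoc-at [] _ _ (q ∷ []) refl
view-neutral x (p ∷ q ∷ r ∷ ps) (ξ-appL s) = NeutralStep-∷ p (view-neutral x (q ∷ r ∷ ps) s)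
view-neutral x (p ∷ q ∷ r ∷ ps) (ξ-appR s) = args-⟶ (here s)
view-neutral x (p ∷ q ∷ r ∷ ps) assoc = assoc-at [] _ _ (q ∷ r ∷ ps) refl

-- An assoc step turns the neutral term into a β-redex whose contractum is again neutral, with the
-- argument (λ A) B contracted in place.
SN-neutral : ∀ x {ps} → SNˢ ps → All SN ps → SN (plug (map farg ps) (var x))
SN-neutral x {ps} (acc rs) as = acc λ s → reduct (view-neutral x ps s)
  where
  reduct : ∀ {T} → NeutralStep x ps T → SN T
  reduct (args-⟶ q) = SN-neutral x (rs q) (All-SN-⟶ˢ q as)
  reduct (assoc-at po A B pi refl) =
    SN-β-expansion (map farg po) M B (transport SN (sym (effArg-args po B)) (SN-app-arg SN-AB)) SN-contractum
    where
    M = app (weaken (plug (map farg pi) (var x))) A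
    SN-AB : SN (app (lam A) B)
    SN-AB = All.head (++⁻ʳ po as)
    contracted : po ++ app (lam A) B ∷ pi ⟶ˢ po ++ A [ B ] ∷ pi
    contracted = ⟶ˢ-++ po pi β
    SN-contractum : SN (contractum (map farg po) M B)
    SN-contractum = transport SN
      (trans (plug-args-++ po (A [ B ]) pi (var x))
             (cong (λ z → plug (map farg po) (app z (A [ B ]))) (sym (weaken-[] (plug (map farg pi) (var x)) B))))
      (SN-neutral x (rs contracted) (All-SN-⟶ˢ contracted as))

module _ {𝒜 : Set} where

  ⟦_⟧ : Type 𝒜 → Term → Set
  ⟦ atom a ⟧ t = SN t
  ⟦ A ⇒ B ⟧  t = ∀ u → ⟦ A ⟧ u → ⟦ B ⟧ (app t u)
  ⟦ A ∧ B ⟧  t = ⟦ A ⟧ t × ⟦ B ⟧ t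

  mutual
    ⟦⟧⇒SN : ∀ A {t} → ⟦ A ⟧ t → SN t
    ⟦⟧⇒SN (atom a) h = h
    ⟦⟧⇒SN (A ⇒ B)  h = SN-app-fun (⟦⟧⇒SN B (h (var 0) (neutral-⟦⟧ A 0 [])))
    ⟦⟧⇒SN (A ∧ B)  h = ⟦⟧⇒SN A (proj₁ h)

    neutral-⟦⟧ : ∀ A x {ps} → All SN ps → ⟦ A ⟧ (plug (map farg ps) (var x))
    neutral-⟦⟧ (atom a) x as      = SN-neutral x (All-SN⇒SNˢ as) as
    neutral-⟦⟧ (A ⇒ B)  x as u hu = neutral-⟦⟧ B x (⟦⟧⇒SN A hu ∷ as)
    neutral-⟦⟧ (A ∧ B)  x as      = neutral-⟦⟧ A x as , neutral-⟦⟧ B x as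

  ⟦⟧-β-expansion : ∀ A M N ps → SN N → ⟦ A ⟧ (plug (map farg ps) (M [ N ])) →
                   ⟦ A ⟧ (plug (map farg ps) (app (lam M) N))
  ⟦⟧-β-expansion (atom a) M N ps sN h =
    SN-β-expansion (map farg ps) M N (transport SN (sym (effArg-args ps N)) sN) h
  ⟦⟧-β-expansion (A ⇒ B) M N ps sN h u hu = ⟦⟧-β-expansion B M N (u ∷ ps) sN (h u hu)
  ⟦⟧-β-expansion (A ∧ B) M N ps sN h =
    ⟦⟧-β-expansion A M N ps sN (proj₁ h) , ⟦⟧-β-expansion B M N ps sN (proj₂ h)

  _⊨_ : Context 𝒜 → (ℕ → Term) → Set
  Γ ⊨ σ = ∀ {n B} → Γ ∋ n ⦂ B → ⟦ B ⟧ (σ n)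

  ⊨-• : ∀ {Γ A σ u} → Γ ⊨ σ → ⟦ A ⟧ u → (A ∷ Γ) ⊨ (u • σ)
  ⊨-• h hu here      = hu
  ⊨-• h hu (there x) = h x

  ⊨-var : ∀ Γ → Γ ⊨ var
  ⊨-var Γ {n} {B} _ = neutral-⟦⟧ B n []

  adequacy : ∀ {Γ t A} → Γ ⊢ t ⦂ A → ∀ {σ} → Γ ⊨ σ → ⟦ A ⟧ (subst σ t)
  adequacy (ax x)  h = h x
  adequacy (→E {N = N} d e) {σ} h = adequacy d h (subst σ N) (adequacy e h)
  adequacy (→I {M = M} {A = A} {B = B} d) {σ} h u hu =
    ⟦⟧-β-expansion B (subst (exts σ) M) u [] (⟦⟧⇒SN A hu)
      (transport ⟦ B ⟧ (sym (exts-[] σ M u)) (adequacy d (⊨-• h hu)))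
  adequacy (∧E₁ d)  h = proj₁ (adequacy d h)
  adequacy (∧E₂ d)  h = proj₂ (adequacy d h)
  adequacy (∧I d e) h = adequacy d h , adequacy e h

corollary1 : {𝒜 : Set} (Γ : Context 𝒜) (t : Term) (A : Type 𝒜) →
             Γ ⊢ t ⦂ A → SN t
corollary1 Γ t A d = transport SN (subst-id t) (⟦⟧⇒SN A (adequacy d (⊨-var Γ)))
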